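{- Let $q$ be a prime power, $n$ a positive integer, and let $\mathcal{F}\subseteq\{1,\ldots,n\}\times\{1,\ldots,n\}$ be a symmetric Ferrers diagram. Then: (1) $\partial(\mathcal{F})=\max\{\mathrm{rk}(M): M\in\mathrm{Sym}_q^{n\times n}[\mathcal{F}]\}$; (2) if $\partial(\mathcal{F})$ is even, then $\partial(\mathcal{F})=\max\{\mathrm{rk}(M): M\in\mathrm{Alt}_q^{n\times n}[\mathcal{F}]\}$.
   Context: A Ferrers diagram is a finite set $\mathcal{F}\subseteq\mathbb{N}\times\mathbb{N}$ ($\mathbb{N}$ the positive integers; $(i,j)$ = row $i$, column $j$) such that $(i,j)\in\mathcal{F}$ implies $(s,t)\in\mathcal{F}$ for all $1\le s\le i$, $1\le t\le j$. It is symmetric if $(i,j)\in\mathcal{F}$ implies $(j,i)\in\mathcal{F}$. A placement of non-attacking rooks is a set of cells no two sharing a row or column index; the degree $\partial(\mathcal{F})$ is the largest $r$ such that $\mathcal{F}$ contains such a placement with $r$ elements. A matrix $M\in\mathbb{F}_q^{n\times n}$ is symmetric if $M_{ij}=M_{ji}$ for all $i,j$ and alternating if $M_{ii}=0$ and $M_{ij}=-M_{ji}$ for all $i,j$. $\mathrm{Sym}_q^{n\times n}[\mathcal{F}]$ (resp. $\mathrm{Alt}_q^{n\times n}[\mathcal{F}]$) is the set of symmetric (resp. alternating) $n\times n$ matrices over $\mathbb{F}_q$ whose support $\{(i,j):M_{ij}\ne0\}$ is contained in $\mathcal{F}$. -}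

module Defs where

open import Level using (Level; _⊔_; 0ℓ)
open import Data.Nat using (ℕ; suc; _≤_)
open import Data.Nat.Primality using (Prime)
open import Data.Fin using (Fin) renaming (_≤_ to _≤ᶠ_)
open import Data.Bool using (Bool; true)
open import Data.Product using (Σ; ∃; ∃-syntax; _×_)
open import Relation.Binary.PropositionalEquality using (_≡_)
import Relation.Binary.PropositionalEquality as ≡
open import Relation.Nullary using (¬_)
open import Function.Bundles using (Inverse)
open import Function.Definitions using (Injective)
open import Algebra.Bundles using (CommutativeRing)
import Algebra.Definitions.RawMonoid as RawMonoidDefs

IsPrimePower : ℕ → Set
IsPrimePower q = Σ ℕ λ p → Σ ℕ λ k → Prime p × 1 ≤ k × q ≡ p Data.Nat.^ k
  where import Data.Nat

record IsFiniteField {c ℓ} (K : CommutativeRing c ℓ) (q : ℕ) : Set (c ⊔ ℓ) where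
  open CommutativeRing K
  field
    nontrivial : ¬ (1# ≈ 0#)
    inverse    : ∀ x → ¬ (x ≈ 0#) → ∃[ y ] (x * y ≈ 1#)
    card       : Inverse setoid (≡.setoid (Fin q))

IsMaximum : ∀ {a} → (ℕ → Set a) → ℕ → Set a
IsMaximum P r = P r × (∀ s → P s → s ≤ r)

-- Subsets of {1..n}×{1..n}; index i : Fin n stands for row/column i+1.
Diagram : ℕ → Set
Diagram n = Fin n → Fin n → Bool

_∈D_ : ∀ {n} → Fin n × Fin n → Diagram n → Set
(i Data.Product., j) ∈D F = F i j ≡ true

IsFerrers : ∀ {n} → Diagram n → Set
IsFerrers {n} F = ∀ (i j s t : Fin n) → F i j ≡ true → s ≤ᶠ i → t ≤ᶠ j → F s t ≡ true

IsSymmetricDiagram : ∀ {n} → Diagram n → Set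
IsSymmetricDiagram {n} F = ∀ (i j : Fin n) → F i j ≡ true → F j i ≡ true

-- F contains a placement of r non-attacking rooks: cells (row k, col k), k < r,
-- with pairwise distinct rows and pairwise distinct columns.
HasRooks : ∀ {n} → Diagram n → ℕ → Set
HasRooks {n} F r = Σ (Fin r → Fin n) λ row → Σ (Fin r → Fin n) λ col →
  Injective _≡_ _≡_ row × Injective _≡_ _≡_ col × (∀ k → F (row k) (col k) ≡ true)

IsDegree : ∀ {n} → Diagram n → ℕ → Set
IsDegree F d = IsMaximum (HasRooks F) d

module MatrixDefs {c ℓ} (K : CommutativeRing c ℓ) where
  open CommutativeRing K
  open RawMonoidDefs +-rawMonoid using (sum)

  Matrix : ℕ → Set c
  Matrix n = Fin n → Fin n → Carrier

  LinIndepColumns : ∀ {n r} → Matrix n → (Fin r → Fin n) → Set (c ⊔ ℓ)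
  LinIndepColumns {n} {r} M col =
    ∀ (a : Fin r → Carrier) → (∀ i → sum (λ k → a k * M i (col k)) ≈ 0#) → ∀ k → a k ≈ 0#

  HasRank : ∀ {n} → Matrix n → ℕ → Set (c ⊔ ℓ)
  HasRank {n} M r = IsMaximum (λ s → Σ (Fin s → Fin n) λ col →
                                  Injective _≡_ _≡_ col × LinIndepColumns M col) r

  IsSymmetricMatrix : ∀ {n} → Matrix n → Set ℓ
  IsSymmetricMatrix M = ∀ i j → M i j ≈ M j i

  IsAlternatingMatrix : ∀ {n} → Matrix n → Set ℓ
  IsAlternatingMatrix M = (∀ i → M i i ≈ 0#) × (∀ i j → M i j ≈ - M j i)

  SupportIn : ∀ {n} → Matrix n → Diagram n → Set ℓ
  SupportIn M F = ∀ i j → ¬ (M i j ≈ 0#) → F i j ≡ true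

  SymRank : ∀ {n} → Diagram n → ℕ → Set (c ⊔ ℓ)
  SymRank F r = Σ (Matrix _) λ M → IsSymmetricMatrix M × SupportIn M F × HasRank M r

  AltRank : ∀ {n} → Diagram n → ℕ → Set (c ⊔ ℓ)
  AltRank F r = Σ (Matrix _) λ M → IsAlternatingMatrix M × SupportIn M F × HasRank M r

module Submission where

-- Let m be the largest k ≤ n such that the whole antidiagonal {(i, j) : i + j = k + 1}
-- lies in F. If m < n, some cell (a + 1, b + 1) with a + b = m is missing, and since F is
-- a Ferrers diagram every cell of F lies in one of the first a rows or the first b columns
-- (if m = n take a = n, b = 0). Hence F carries at most a + b = m non-attacking rooks, and
-- a matrix supported in F has rank at most m, because its columns of index > b are
-- supported in the first a rows. Conversely the antidiagonal carries m rooks, so ∂(F) = m,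
-- and m is attained as the rank of the antidiagonal matrix with entries 1 (symmetric) or
-- with entries ±1 according to the sign of j − i (alternating; for m even the
-- antidiagonal misses the main diagonal).

open import Defs
open import Level using (Level; _⊔_)
open import Data.Bool using (true; false)
import Data.Bool.Properties as Bool
open import Data.Empty using (⊥-elim)
open import Data.Fin using (Fin; zero; suc; toℕ; fromℕ<; inject≤; opposite; punchIn; _↑ˡ_; _↑ʳ_)
import Data.Fin.Properties as Fin
open import Data.Nat as ℕ using (ℕ; zero; suc; _≤_; _<_; z≤n; s≤s)
import Data.Nat.Properties as ℕ
open import Data.Nat.Divisibility using (_∣_; divides; ∣1⇒≡1; ∣m+n∣m⇒∣n)
open import Data.Product using (_×_; _,_; ∃-syntax)
open import Data.Sum using (_⊎_; inj₁; inj₂)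
open import Data.Vec.Functional using (_++_; insertAt; tail)
open import Data.Vec.Functional.Properties using (lookup-++ˡ; lookup-++ʳ; insertAt-lookup; insertAt-punchIn)
open import Function using (_∘_)
open import Function.Definitions using (Injective)
open import Function.Properties.Inverse using (Inverse⇒Injection)
open import Relation.Binary.Definitions using (Decidable)
open import Relation.Binary.PropositionalEquality as ≡ using (_≡_; _≢_)
open import Relation.Nullary using (¬_; Dec; yes; no; ¬?; contradiction)
open import Relation.Nullary.Decidable using (_×-dec_; via-injection; decidable-stable)
open import Algebra.Bundles using (CommutativeRing)

module _ {n : ℕ} (F : Diagram n) where

  open import Data.Nat.Base using (_+_)

  -- Indices are 0-based: in the paper's numbering these are the cells with i + j = m + 1.
  AntidiagonalIn : ℕ → Set
  AntidiagonalIn m = ∀ i j → suc (toℕ i + toℕ j) ≡ m → F i j ≡ true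

  CoveredBy : ℕ → ℕ → Set
  CoveredBy a b = ∀ i j → F i j ≡ true → toℕ i < a ⊎ toℕ j < b

  -- König's theorem for a Ferrers board: a full antidiagonal of length depth and
  -- a cover of the board by depth lines.
  record AntidiagonalCover : Set where
    field
      depth rows cols : ℕ
      depth≤n         : depth ≤ n
      rows≤n          : rows ≤ n
      rows+cols≡depth : rows + cols ≡ depth
      full            : AntidiagonalIn depth
      covered         : CoveredBy rows cols

  Gap : ℕ → Set
  Gap k = ∃[ i ] ∃[ j ] suc (toℕ i + toℕ j) ≡ k × F i j ≡ false

  gap? : ∀ k → Dec (Gap k)
  gap? k = Fin.any? λ i → Fin.any? λ j → (suc (toℕ i + toℕ j) ℕ.≟ k) ×-dec (F i j Bool.≟ false)

  no-gap⇒antidiagonal : ∀ {k} → ¬ Gap k → AntidiagonalIn k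
  no-gap⇒antidiagonal ¬gap i j ij≡k with F i j in Fij
  ... | true  = ≡.refl
  ... | false = ⊥-elim (¬gap (i , j , ij≡k , Fij))

  module _ (ferrers : IsFerrers F) where

    ferrers-gap⇒covered : ∀ {i j} → F i j ≡ false → CoveredBy (toℕ i) (toℕ j)
    ferrers-gap⇒covered {i} {j} Fij≡false r s Frs with toℕ r ℕ.<? toℕ i | toℕ s ℕ.<? toℕ j
    ... | yes r<i | _        = inj₁ r<i
    ... | no _    | yes s<j  = inj₂ s<j
    ... | no r≮i  | no s≮j   =
      contradiction (≡.trans (≡.sym (ferrers r s i j Frs (ℕ.≮⇒≥ r≮i) (ℕ.≮⇒≥ s≮j))) Fij≡false) λ ()

    -- Inspect the antidiagonals k, k + 1, …, n (t = n − k of them) up to the first one with a gap.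
    antidiagonalCover-from : ∀ t k → t + k ≡ n → AntidiagonalIn k → AntidiagonalCover
    antidiagonalCover-from zero k k≡n full = record
      { depth = k ; rows = k ; cols = 0
      ; depth≤n = ℕ.≤-reflexive k≡n ; rows≤n = ℕ.≤-reflexive k≡n
      ; rows+cols≡depth = ℕ.+-identityʳ k
      ; full = full
      ; covered = λ i _ _ → inj₁ (≡.subst (toℕ i <_) (≡.sym k≡n) (Fin.toℕ<n i))
      }
    antidiagonalCover-from (suc t) k t+k≡n full with gap? (suc k)
    ... | no ¬gap = antidiagonalCover-from t (suc k) (≡.trans (ℕ.+-suc t k) t+k≡n) (no-gap⇒antidiagonal ¬gap)
    ... | yes (i , j , ij≡k , Fij) = record
      { depth = k ; rows = toℕ i ; cols = toℕ j
      ; depth≤n = ≡.subst (k ≤_) t+k≡n (ℕ.m≤n+m k (suc t))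
      ; rows≤n = ℕ.<⇒≤ (Fin.toℕ<n i)
      ; rows+cols≡depth = ℕ.suc-injective ij≡k
      ; full = full
      ; covered = ferrers-gap⇒covered Fij
      }

    ferrers⇒antidiagonalCover : AntidiagonalCover
    ferrers⇒antidiagonalCover = antidiagonalCover-from n 0 (ℕ.+-identityʳ n) (λ _ _ ())

module _ {m n : ℕ} (m≤n : m ≤ n) where

  open import Data.Nat.Base using (_+_)

  embed : Fin m → Fin n
  embed k = inject≤ k m≤n

  partner : Fin m → Fin n
  partner k = inject≤ (opposite k) m≤n

  partner-on-antidiagonal : ∀ k → suc (toℕ (partner k) + toℕ (embed k)) ≡ m
  partner-on-antidiagonal k = begin
    suc (toℕ (partner k) + toℕ (embed k)) ≡⟨ ≡.cong₂ (λ x y → suc (x + y)) toℕ-partner (Fin.toℕ-inject≤ k m≤n) ⟩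
    suc (m ℕ.∸ suc (toℕ k) + toℕ k)       ≡⟨ ≡.sym (ℕ.+-suc (m ℕ.∸ suc (toℕ k)) (toℕ k)) ⟩
    m ℕ.∸ suc (toℕ k) + suc (toℕ k)       ≡⟨ ℕ.m∸n+n≡m (Fin.toℕ<n k) ⟩
    m                                     ∎
    where
    open ≡.≡-Reasoning
    toℕ-partner : toℕ (partner k) ≡ m ℕ.∸ suc (toℕ k)
    toℕ-partner = ≡.trans (Fin.toℕ-inject≤ (opposite k) m≤n) (Fin.opposite-prop k)

  partner-unique : ∀ k j → suc (toℕ (partner k) + toℕ (embed j)) ≡ m → j ≡ k
  partner-unique k j on = Fin.inject≤-injective m≤n m≤n j k (Fin.toℕ-injective
    (ℕ.+-cancelˡ-≡ (suc (toℕ (partner k))) _ _ (≡.trans on (≡.sym (partner-on-antidiagonal k)))))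

  partner-injective : Injective _≡_ _≡_ partner
  partner-injective {x} {y} px≡py =
    partner-unique y x (≡.subst (λ p → suc (toℕ p + toℕ (embed x)) ≡ m) px≡py (partner-on-antidiagonal x))

  embed-injective : Injective _≡_ _≡_ embed
  embed-injective = Fin.inject≤-injective m≤n m≤n _ _

  antidiagonal-rooks : ∀ {F : Diagram n} → AntidiagonalIn F m → HasRooks F m
  antidiagonal-rooks full =
    partner , embed , partner-injective , embed-injective , λ k → full _ _ (partner-on-antidiagonal k)

odd-not-even : ∀ x → ¬ 2 ∣ suc (x ℕ.+ x)
odd-not-even x 2∣odd = contradiction (∣1⇒≡1 (∣m+n∣m⇒∣n 2∣odd′ 2∣even)) λ ()
  where
  2∣odd′ : 2 ∣ (x ℕ.+ x) ℕ.+ 1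
  2∣odd′ = ≡.subst (2 ∣_) (ℕ.+-comm 1 (x ℕ.+ x)) 2∣odd
  2∣even : 2 ∣ x ℕ.+ x
  2∣even = divides x (≡.trans (≡.cong (x ℕ.+_) (≡.sym (ℕ.+-identityʳ x))) (ℕ.*-comm 2 x))

module Matrices {c ℓ} (K : CommutativeRing c ℓ) where

  open CommutativeRing K hiding (zero)
  open MatrixDefs K
  open import Algebra.Properties.Semiring.Sum semiring
    using (sum; sum-cong-≋; sum-replicate-zero; sum-remove; ∑-distrib-+; *-distribʳ-sum)
  open import Algebra.Properties.Ring ring using (-1*x≈-x; -‿distribˡ-*)
  open import Algebra.Properties.AbelianGroup +-abelianGroup using (⁻¹-involutive; ε⁻¹≈ε)
  open import Relation.Binary.Reasoning.Setoid setoid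

  𝟙 : ∀ {p} {P : Set p} → Dec P → Carrier
  𝟙 (yes _) = 1#
  𝟙 (no _)  = 0#

  𝟙-yes : ∀ {p} {P : Set p} (P? : Dec P) → P → 𝟙 P? ≡ 1#
  𝟙-yes (yes _) _ = ≡.refl
  𝟙-yes (no ¬p) p = contradiction p ¬p

  𝟙-no : ∀ {p} {P : Set p} (P? : Dec P) → ¬ P → 𝟙 P? ≡ 0#
  𝟙-no (yes p) ¬p = contradiction p ¬p
  𝟙-no (no _)  _  = ≡.refl

  sum-zero : ∀ {k} (f : Fin k → Carrier) → (∀ j → f j ≈ 0#) → sum f ≈ 0#
  sum-zero {k} f f≈0 = trans (sum-cong-≋ f≈0) (sum-replicate-zero k)

  sum-single : ∀ {k} (f : Fin (suc k) → Carrier) p → (∀ j → j ≢ p → f j ≈ 0#) → sum f ≈ f p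
  sum-single f p others≈0 = begin
    sum f                       ≈⟨ sum-remove {i = p} f ⟩
    f p + sum (f ∘ punchIn p)   ≈⟨ +-congˡ (sum-zero _ (λ j → others≈0 _ (Fin.punchInᵢ≢i p j))) ⟩
    f p + 0#                    ≈⟨ +-identityʳ _ ⟩
    f p                         ∎

  isolated-unit-coefficient : ∀ {s} (a v : Fin s → Carrier) k {w} → v k * w ≈ 1# →
    (∀ j → j ≢ k → v j ≈ 0#) → sum (λ j → a j * v j) ≈ 0# → a k ≈ 0#
  isolated-unit-coefficient {suc _} a v k {w} vw≈1 others≈0 ∑≈0 = begin
    a k                ≈⟨ sym (*-identityʳ (a k)) ⟩
    a k * 1#           ≈⟨ *-congˡ (sym vw≈1) ⟩
    a k * (v k * w)    ≈⟨ sym (*-assoc (a k) (v k) w) ⟩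
    (a k * v k) * w    ≈⟨ *-congʳ (trans (sym (sum-single (λ j → a j * v j) k λ j j≢k → trans (*-congˡ (others≈0 j j≢k)) (zeroʳ (a j)))) ∑≈0) ⟩
    0# * w             ≈⟨ zeroˡ w ⟩
    0#                 ∎

  module _ {n : ℕ} (m : ℕ) (σ : Fin n → Fin n → Carrier) where

    antidiagonal : Matrix n
    antidiagonal i j = σ i j * 𝟙 (suc (toℕ i ℕ.+ toℕ j) ℕ.≟ m)

    antidiagonal-on : ∀ {i j} → suc (toℕ i ℕ.+ toℕ j) ≡ m → antidiagonal i j ≈ σ i j
    antidiagonal-on on = trans (*-congˡ (reflexive (𝟙-yes (_ ℕ.≟ m) on))) (*-identityʳ _)

    antidiagonal-off : ∀ {i j} → suc (toℕ i ℕ.+ toℕ j) ≢ m → antidiagonal i j ≈ 0#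
    antidiagonal-off off = trans (*-congˡ (reflexive (𝟙-no (_ ℕ.≟ m) off))) (zeroʳ _)

    antidiagonal-supportIn : ∀ {F} → AntidiagonalIn F m → SupportIn antidiagonal F
    antidiagonal-supportIn full i j entry≉0 =
      full i j (decidable-stable (_ ℕ.≟ m) λ off → entry≉0 (antidiagonal-off off))

    antidiagonal-independent : (m≤n : m ≤ n) → (∀ i j → σ i j * σ i j ≈ 1#) →
      LinIndepColumns antidiagonal (embed m≤n)
    antidiagonal-independent m≤n unit cc ∑≈0 k = isolated-unit-coefficient cc (λ j → antidiagonal i (embed m≤n j)) k
      (trans (*-congʳ (antidiagonal-on (partner-on-antidiagonal m≤n k))) (unit _ _))
      (λ j j≢k → antidiagonal-off λ on → j≢k (partner-unique m≤n k j on))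
      (∑≈0 i)
      where i = partner m≤n k

    antidiagonal-symmetric : (∀ i j → σ i j ≈ σ j i) → IsSymmetricMatrix antidiagonal
    antidiagonal-symmetric σ-sym i j =
      *-cong (σ-sym i j) (reflexive (≡.cong (λ s → 𝟙 (suc s ℕ.≟ m)) (ℕ.+-comm (toℕ i) (toℕ j))))

    antidiagonal-alternating : (∀ i j → i ≢ j → σ i j ≈ - σ j i) → (∀ x → suc (x ℕ.+ x) ≢ m) →
      IsAlternatingMatrix antidiagonal
    antidiagonal-alternating σ-anti odd≢m = (λ i → antidiagonal-off (odd≢m (toℕ i))) , skew
      where
      skew : ∀ i j → antidiagonal i j ≈ - antidiagonal j i
      skew i j = skew-by (suc (toℕ i ℕ.+ toℕ j) ℕ.≟ m)
        where
        j+i≡i+j : suc (toℕ j ℕ.+ toℕ i) ≡ suc (toℕ i ℕ.+ toℕ j)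
        j+i≡i+j = ≡.cong suc (ℕ.+-comm (toℕ j) (toℕ i))
        skew-by : Dec (suc (toℕ i ℕ.+ toℕ j) ≡ m) → antidiagonal i j ≈ - antidiagonal j i
        skew-by (yes on) = begin
          antidiagonal i j   ≈⟨ antidiagonal-on on ⟩
          σ i j              ≈⟨ σ-anti i j (λ { ≡.refl → odd≢m (toℕ i) on }) ⟩
          - σ j i            ≈⟨ -‿cong (sym (antidiagonal-on (≡.trans j+i≡i+j on))) ⟩
          - antidiagonal j i ∎
        skew-by (no off) = begin
          antidiagonal i j   ≈⟨ antidiagonal-off off ⟩
          0#                 ≈⟨ sym ε⁻¹≈ε ⟩
          - 0#               ≈⟨ -‿cong (sym (antidiagonal-off (off ∘ ≡.trans (≡.sym j+i≡i+j)))) ⟩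
          - antidiagonal j i ∎

  sign : ∀ {n} → Fin n → Fin n → Carrier
  sign i j with i Fin.<? j
  ... | yes _ = 1#
  ... | no _  = - 1#

  sign-unit : ∀ {n} (i j : Fin n) → sign i j * sign i j ≈ 1#
  sign-unit i j with i Fin.<? j
  ... | yes _ = *-identityˡ 1#
  ... | no _  = trans (-1*x≈-x (- 1#)) (⁻¹-involutive 1#)

  sign-antisymmetric : ∀ {n} (i j : Fin n) → i ≢ j → sign i j ≈ - sign j i
  sign-antisymmetric i j i≢j with i Fin.<? j | j Fin.<? i
  ... | yes i<j | yes j<i = contradiction j<i (Fin.<-asym i<j)
  ... | yes _   | no _    = sym (⁻¹-involutive 1#)
  ... | no _    | yes _   = refl
  ... | no i≮j  | no j≮i  = contradiction (Fin.toℕ-injective (ℕ.≤-antisym (ℕ.≮⇒≥ j≮i) (ℕ.≮⇒≥ i≮j))) i≢j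

  Independent : ∀ {k N} → (Fin k → Fin N → Carrier) → Set (c ⊔ ℓ)
  Independent {k} v = ∀ (a : Fin k → Carrier) → (∀ i → sum (λ j → a j * v j i) ≈ 0#) → ∀ j → a j ≈ 0#

  independent-tail : ∀ {k N} (v : Fin k → Fin (suc N) → Carrier) →
    (∀ j → v j zero ≈ 0#) → Independent v → Independent (tail ∘ v)
  independent-tail v v₀≈0 ind a ∑≈0 = ind a λ where
    zero    → sum-zero _ (λ j → trans (*-congˡ (v₀≈0 j)) (zeroʳ (a j)))
    (suc i) → ∑≈0 i

  -- Gaussian elimination: clear the first coordinate of every vⱼ against the pivot vₚ.
  module Pivot {k N} (v : Fin (suc k) → Fin (suc N) → Carrier) (p : Fin (suc k)) {α}
               (pivot : v p zero * α ≈ 1#) where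

    multiplier : Fin k → Carrier
    multiplier j = - (v (punchIn p j) zero * α)

    eliminate : Fin k → Fin (suc N) → Carrier
    eliminate j i = v (punchIn p j) i + multiplier j * v p i

    eliminate-zero : ∀ j → eliminate j zero ≈ 0#
    eliminate-zero j = begin
      x + - (x * α) * v p zero   ≈⟨ +-congˡ (sym (-‿distribˡ-* _ _)) ⟩
      x + - (x * α * v p zero)   ≈⟨ +-congˡ (-‿cong (*-assoc x α (v p zero))) ⟩
      x + - (x * (α * v p zero)) ≈⟨ +-congˡ (-‿cong (*-congˡ (trans (*-comm α _) pivot))) ⟩
      x + - (x * 1#)             ≈⟨ +-congˡ (-‿cong (*-identityʳ x)) ⟩
      x + - x                    ≈⟨ -‿inverseʳ x ⟩
      0#                         ∎
      where
      x = v (punchIn p j) zero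

    combination-eliminate : ∀ (a : Fin k → Carrier) i →
      sum (λ x → insertAt a p (sum (λ j → a j * multiplier j)) x * v x i) ≈ sum (λ j → a j * eliminate j i)
    combination-eliminate a i = begin
      sum (λ x → e x * v x i)                               ≈⟨ sum-remove {i = p} (λ x → e x * v x i) ⟩
      e p * v p i + sum (λ j → e (punchIn p j) * v (punchIn p j) i)
        ≈⟨ +-cong (*-congʳ (reflexive (insertAt-lookup a p β)))
                  (sum-cong-≋ λ j → *-congʳ (reflexive (insertAt-punchIn a p β j))) ⟩
      β * v p i + sum (λ j → a j * v (punchIn p j) i)       ≈⟨ +-comm _ _ ⟩
      sum (λ j → a j * v (punchIn p j) i) + β * v p i       ≈⟨ +-congˡ (*-distribʳ-sum (v p i) (λ j → a j * multiplier j)) ⟩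
      sum (λ j → a j * v (punchIn p j) i) + sum (λ j → a j * multiplier j * v p i)
        ≈⟨ sym (∑-distrib-+ (λ j → a j * v (punchIn p j) i) (λ j → a j * multiplier j * v p i)) ⟩
      sum (λ j → a j * v (punchIn p j) i + a j * multiplier j * v p i)
        ≈⟨ sum-cong-≋ (λ j → trans (+-congˡ (*-assoc (a j) (multiplier j) (v p i))) (sym (distribˡ (a j) _ _))) ⟩
      sum (λ j → a j * eliminate j i)                        ∎
      where
      β = sum (λ j → a j * multiplier j)
      e = insertAt a p β

    independent-eliminate : Independent v → Independent (tail ∘ eliminate)
    independent-eliminate ind a ∑≈0 j =
      ≡.subst (_≈ 0#) (insertAt-punchIn a p β j) (ind (insertAt a p β) combination≈0 (punchIn p j))
      where
      β = sum (λ l → a l * multiplier l)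
      combination≈0 : ∀ i → sum (λ x → insertAt a p β x * v x i) ≈ 0#
      combination≈0 zero    = trans (combination-eliminate a zero)
                                    (sum-zero _ λ l → trans (*-congˡ (eliminate-zero l)) (zeroʳ _))
      combination≈0 (suc i) = trans (combination-eliminate a (suc i)) (∑≈0 i)

  module DiscreteField (nontrivial : ¬ 1# ≈ 0#) (inverse : ∀ x → ¬ x ≈ 0# → ∃[ y ] x * y ≈ 1#)
                       (_≈?_ : Decidable _≈_) where

    independent⇒≤ : ∀ N {k} (v : Fin k → Fin N → Carrier) → Independent v → k ≤ N
    independent⇒≤ _       {zero}  _ _   = z≤n
    independent⇒≤ zero    {suc k} v ind = ⊥-elim (nontrivial (ind (λ _ → 1#) (λ ()) zero))
    independent⇒≤ (suc N) {suc k} v ind with Fin.any? (λ p → ¬? (v p zero ≈? 0#))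
    ... | no no-pivot = ℕ.m≤n⇒m≤1+n (independent⇒≤ N (tail ∘ v) (independent-tail v v₀≈0 ind))
      where
      v₀≈0 : ∀ j → v j zero ≈ 0#
      v₀≈0 j with v j zero ≈? 0#
      ... | yes v₀≈0 = v₀≈0
      ... | no  v₀≉0 = contradiction (j , v₀≉0) no-pivot
    ... | yes (p , vₚ≉0) with inverse (v p zero) vₚ≉0
    ...   | α , pivot = s≤s (independent⇒≤ N (tail ∘ eliminate) (independent-eliminate ind))
      where open Pivot v p pivot

    -- Columns with index ≥ b live in the first a rows, and columns with index < b
    -- are told apart by the unit vectors appended below.
    independent-columns-≤-cover : ∀ {n} {F : Diagram n} {M : Matrix n} {a b} →
      SupportIn M F → CoveredBy F a b → a ≤ n →
      ∀ {s} {col : Fin s → Fin n} → Injective _≡_ _≡_ col → LinIndepColumns M col → s ≤ a ℕ.+ b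
    independent-columns-≤-cover {M = M} {a} {b} supp covered a≤n {s} {col} col-inj indM =
      independent⇒≤ (a ℕ.+ b) u (λ cc ∑≈0 → indM cc (row-sum≈0 cc ∑≈0))
      where
      top : Fin s → Fin a → Carrier
      top k i = M (inject≤ i a≤n) (col k)

      indicator : Fin s → Fin b → Carrier
      indicator k t = 𝟙 (toℕ (col k) ℕ.≟ toℕ t)

      u : Fin s → Fin (a ℕ.+ b) → Carrier
      u k = top k ++ indicator k

      module _ (cc : Fin s → Carrier) (∑≈0 : ∀ i → sum (λ j → cc j * u j i) ≈ 0#) where

        low-column-coefficient : ∀ k → toℕ (col k) < b → cc k ≈ 0#
        low-column-coefficient k lt = isolated-unit-coefficient cc (λ j → u j (a ↑ʳ t)) k
          (trans (*-congʳ (reflexive (≡.trans (unit-entry k) (𝟙-yes (toℕ (col k) ℕ.≟ toℕ t) col≡t)))) (*-identityˡ 1#))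
          other≈0 (∑≈0 (a ↑ʳ t))
          where
          t = fromℕ< lt
          col≡t : toℕ (col k) ≡ toℕ t
          col≡t = ≡.sym (Fin.toℕ-fromℕ< lt)
          unit-entry : ∀ j → u j (a ↑ʳ t) ≡ 𝟙 (toℕ (col j) ℕ.≟ toℕ t)
          unit-entry j = lookup-++ʳ (top j) (indicator j) t
          other≈0 : ∀ j → j ≢ k → u j (a ↑ʳ t) ≈ 0#
          other≈0 j j≢k = reflexive (≡.trans (unit-entry j) (𝟙-no (toℕ (col j) ℕ.≟ toℕ t)
            λ e → j≢k (col-inj (Fin.toℕ-injective (≡.trans e (Fin.toℕ-fromℕ< lt))))))

        row-sum≈0 : ∀ i → sum (λ k → cc k * M i (col k)) ≈ 0#
        row-sum≈0 i with toℕ i ℕ.<? a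
        ... | yes i<a = trans (sum-cong-≋ λ k → *-congˡ (reflexive (≡.sym (top-entry k)))) (∑≈0 (fromℕ< i<a ↑ˡ b))
          where
          top-entry : ∀ k → u k (fromℕ< i<a ↑ˡ b) ≡ M i (col k)
          top-entry k = ≡.trans (lookup-++ˡ (top k) (indicator k) (fromℕ< i<a)) (≡.cong (λ r → M r (col k))
            (Fin.toℕ-injective (≡.trans (Fin.toℕ-inject≤ _ a≤n) (Fin.toℕ-fromℕ< i<a))))
        ... | no i≮a = sum-zero _ term≈0
          where
          term≈0 : ∀ k → cc k * M i (col k) ≈ 0#
          term≈0 k with M i (col k) ≈? 0#
          ... | yes entry≈0 = trans (*-congˡ entry≈0) (zeroʳ _)
          ... | no  entry≉0 with covered i (col k) (supp i (col k) entry≉0)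
          ...   | inj₁ i<a   = contradiction i<a i≮a
          ...   | inj₂ col<b = trans (*-congʳ (low-column-coefficient k col<b)) (zeroˡ _)

    rooks-≤-cover : ∀ {n} {F : Diagram n} {a b r} → CoveredBy F a b → a ≤ n → HasRooks F r → r ≤ a ℕ.+ b
    rooks-≤-cover {F = F} covered a≤n (row , col , row-inj , col-inj , on-board) =
      independent-columns-≤-cover supp covered a≤n col-inj independent
      where
      rook? : ∀ i j → Dec (∃[ k ] row k ≡ i × col k ≡ j)
      rook? i j = Fin.any? λ k → (row k Fin.≟ i) ×-dec (col k Fin.≟ j)

      P : Matrix _
      P i j = 𝟙 (rook? i j)

      supp : SupportIn P F
      supp i j P≉0 with rook? i j
      ... | yes (k , ≡.refl , ≡.refl) = on-board k
      ... | no _ = contradiction refl P≉0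

      independent : LinIndepColumns P col
      independent cc ∑≈0 k = isolated-unit-coefficient cc (λ j → P (row k) (col j)) k
        (trans (*-congʳ (reflexive (𝟙-yes (rook? _ _) (k , ≡.refl , ≡.refl)))) (*-identityˡ 1#))
        (λ j j≢k → reflexive (𝟙-no (rook? _ _) λ (k′ , rk′ , ck′) → j≢k (≡.trans (≡.sym (col-inj ck′)) (row-inj rk′))))
        (∑≈0 (row k))

    module Extremal {n} {F : Diagram n} (C : AntidiagonalCover F) where

      open AntidiagonalCover C

      independent-columns-≤-depth : ∀ {M s} {col : Fin s → Fin n} → SupportIn M F →
        Injective _≡_ _≡_ col → LinIndepColumns M col → s ≤ depth
      independent-columns-≤-depth supp col-inj indep =
        ≡.subst (_ ≤_) rows+cols≡depth (independent-columns-≤-cover supp covered rows≤n col-inj indep)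

      rank-≤-depth : ∀ {M s} → SupportIn M F → HasRank M s → s ≤ depth
      rank-≤-depth supp ((_ , col-inj , indep) , _) = independent-columns-≤-depth supp col-inj indep

      antidiagonal-hasRank : ∀ σ → (∀ i j → σ i j * σ i j ≈ 1#) → HasRank (antidiagonal depth σ) depth
      antidiagonal-hasRank σ unit =
        (embed depth≤n , embed-injective depth≤n , antidiagonal-independent depth σ depth≤n unit) ,
        λ _ (_ , col-inj , indep) → independent-columns-≤-depth (antidiagonal-supportIn depth σ full) col-inj indep

      degree≡depth : ∀ {d} → IsDegree F d → d ≡ depth
      degree≡depth (rooks , maximal) = ℕ.≤-antisym
        (≡.subst (_ ≤_) rows+cols≡depth (rooks-≤-cover covered rows≤n rooks))
        (maximal depth (antidiagonal-rooks depth≤n full))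

lemma4p3 : ∀ {c ℓ : Level} (q : ℕ) (K : CommutativeRing c ℓ) → IsPrimePower q → IsFiniteField K q →
    ∀ (n : ℕ) → 1 ≤ n → (F : Diagram n) → IsFerrers F → IsSymmetricDiagram F →
    ∀ (d : ℕ) → IsDegree F d →
    IsMaximum (MatrixDefs.SymRank K F) d × (2 ∣ d → IsMaximum (MatrixDefs.AltRank K F) d)
lemma4p3 q K _ FF n _ F ferrers _ d degree = symmetric-part , alternating-part
  where
  open CommutativeRing K using (Carrier; 1#; *-identityˡ; refl)
  open IsFiniteField FF
  open MatrixDefs K
  open Matrices K
  C = ferrers⇒antidiagonalCover F ferrers
  open AntidiagonalCover C using (depth; full)
  open DiscreteField nontrivial inverse (via-injection (Inverse⇒Injection card) Fin._≟_)
  open Extremal C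

  ones : Fin n → Fin n → Carrier
  ones _ _ = 1#

  symmetric-part : IsMaximum (SymRank F) d
  symmetric-part rewrite degree≡depth degree =
    (antidiagonal depth ones , antidiagonal-symmetric depth ones (λ _ _ → refl)
      , antidiagonal-supportIn depth ones full , antidiagonal-hasRank ones (λ _ _ → *-identityˡ 1#)) ,
    λ _ (_ , _ , supp , rank) → rank-≤-depth supp rank

  alternating-part : 2 ∣ d → IsMaximum (AltRank F) d
  alternating-part 2∣d rewrite degree≡depth degree =
    (antidiagonal depth sign , antidiagonal-alternating depth sign sign-antisymmetric depth-even
      , antidiagonal-supportIn depth sign full , antidiagonal-hasRank sign sign-unit) ,
    λ _ (_ , _ , supp , rank) → rank-≤-depth supp rank
    where
    depth-even : ∀ x → suc (x ℕ.+ x) ≢ depth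
    depth-even x odd≡depth = odd-not-even x (≡.subst (2 ∣_) (≡.sym odd≡depth) 2∣d)
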